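{- Let $\mathcal{I}$ be an inference system over a set $\mathcal{S}$ of propositions, with a fixed well-founded strict order $\prec$ on $\mathcal{S}$, such that: $\mathcal{I}$ is finite in conclusions and has a complement $\mathcal{J}$; $\mathcal{I}$ is included in and equivalent to a saturated system $\mathcal{I}'$; and the system $\mathcal{A}$ obtained by selecting the introduction rules of $\mathcal{I}'$ is finite in conclusions and has a complement $\mathcal{B}$. Let $A$ be a proposition such that the sequent $\not\vdash A$ has a proof in $\mathcal{A}_{\mathcal{B}}$, and let $\langle C_1,\dots,C_n\rangle$ be a sequence of premises from which $A$ is derivable with a rule of $\mathcal{I}$. Then there exists $i$ such that the sequent $\not\vdash C_i$ has a proof in $\mathcal{A}_{\mathcal{B}}$.
   Context: An inference rule over $\mathcal{S}$ is a partial function $f:\mathcal{S}^n\rightharpoonup\mathcal{S}$ ($n\ge0$); $B$ is derivable from $\langle A_1,\dots,A_n\rangle$ with $f$ if $f(A_1,\dots,A_n)$ is defined and equals $B$. An inference system is a set of rules; it is finite in conclusions if each proposition is derivable with a rule of the system from only finitely many sequences. A proof is a (possibly infinite) tree labeled with propositions (or sequents) where every node labeled $B$ with children labeled $A_1,\dots,A_n$ has $B$ derivable from $\langle A_1,\dots,A_n\rangle$ by a rule of the system. Two systems are equivalent if the same propositions have finite proofs in them. Complement: for $\mathcal{I}$ finite in conclusions, $\mathcal{J}$ is a complement of $\mathcal{I}$ if $\mathcal{J}$ is finite in conclusions and for every $B$, if $\langle A^1_1,\dots,A^1_{n_1}\rangle,\dots,\langle A^p_1,\dots,A^p_{n_p}\rangle$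 are all sequences from which $B$ is derivable with a rule of $\mathcal{I}$, then the sequences from which $B$ is derivable with a rule of $\mathcal{J}$ are exactly the $\langle A^1_{j_1},\dots,A^p_{j_p}\rangle$, $1\le j_i\le n_i$. The complementation $\mathcal{A}_{\mathcal{B}}$ is the system on sequents $\vdash A$, $\not\vdash A$ with, for each $f\in\mathcal{A}$, the rule $\vdash A_1,\dots,\vdash A_n\mapsto\ \vdash f(A_1,\dots,A_n)$, and for each $f\in\mathcal{B}$, the rule $\not\vdash A_1,\dots,\not\vdash A_n\mapsto\ \not\vdash f(A_1,\dots,A_n)$. Introduction rules: a rule $r$ is an introduction rule if whenever $B$ is derivable from $\langle A_1,\dots,A_n\rangle$ with $r$, $A_i\prec B$ for all $i$. For each non-introduction rule, its major premises are its $m$ leftmost premises for some $m\ge1$. Composition: if $g$ has $n$ premises and each $f_i$ is either a rule with $m_i$ premises or the identity ($m_i=1$), the composition of $g$ with $f_1,\dots,f_n$ is $h(x^1_1,\dots,x^n_{m_n})=g(f_1(x^1_1,\dots,x^1_{m_1}),\dots,f_n(x^n_1,\dots,x^n_{m_n}))$, defined when all applications are defined. Simplification: if for a rule with domain $D$ there are positions $i\neq j$ with $x_i=x_j$ on all of $D$, the rule may be replaced by the one dropping the $j$-th argument (using $x_i$ in its place); the simplification is the result of doing this until no such pair remains. A system is saturated if whenever it contains a non-introduction rule $g$ with $n$ premises whose $m$ leftmost premises are major and $m$ introduction rules $f_1,\dots,f_m$, it also contains the simplification of the composition of $g$ with $f_1,\dots,f_m$ and $n-m$ identity functions. -}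

module Defs where

open import Data.Nat using (ℕ; zero; suc; _+_; _∸_; _≤_; _<_)
open import Data.List using (List; []; _∷_; _++_; map; length; replicate)
open import Data.List.Properties using (length-map; map-injective)
open import Data.Maybe using (Maybe; just; nothing)
open import Data.Product using (Σ; _×_; _,_; proj₁; proj₂; ∃)
open import Data.Sum using (_⊎_; inj₁; inj₂)
open import Function using (_∘_)
open import Relation.Binary.PropositionalEquality
open import Relation.Nullary using (¬_)
open import Data.List.Membership.Propositional using (_∈_)
open import Data.List.Relation.Unary.All using (All)
open import Data.List.Relation.Unary.Unique.Propositional using (Unique)
open import Data.List.Relation.Binary.Pointwise using (Pointwise)
open import Function.Bundles using (_⇔_)

-- Inference rules: partial functions X^n ⇀ X, given by their graph.
-- R xs b  means  "b is derivable from the sequence xs with the rule".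

record Rule (X : Set) : Set₁ where
  field
    arity      : ℕ
    R          : List X → X → Set
    arity-ok   : ∀ {xs b} → R xs b → length xs ≡ arity
    functional : ∀ {xs b c} → R xs b → R xs c → b ≡ c
open Rule public

-- A bare "graph" of a (possibly constructed) rule: arity + relation.
-- Used for rules built by composition / simplification, which are only
-- ever compared extensionally with rules of a system.
record Graph (X : Set) : Set₁ where
  constructor mkGraph
  field
    g-arity : ℕ
    G       : List X → X → Set
open Graph public

toGraph : ∀ {X} → Rule X → Graph X
toGraph r = mkGraph (arity r) (R r)

_≅_ : ∀ {X} → Graph X → Graph X → Set
g ≅ h = (g-arity g ≡ g-arity h) × (∀ xs b → G g xs b ⇔ G h xs b)

record System (X : Set) : Set₁ where
  field
    Idx  : Set
    rule : Idx → Rule X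
open System public

Derivable : ∀ {X} → System X → X → List X → Set
Derivable I B xs = Σ (Idx I) λ i → R (rule I i) xs B

Contains : ∀ {X} → System X → Graph X → Set
Contains I g = Σ (Idx I) λ i → toGraph (rule I i) ≅ g

Included : ∀ {X} → System X → System X → Set
Included I I' = ∀ i → Contains I' (toGraph (rule I i))

FinConc : ∀ {X} → System X → Set
FinConc {X} I = ∀ (B : X) → Σ (List (List X)) λ L →
  ∀ xs → Derivable I B xs ⇔ (xs ∈ L)

Complement : ∀ {X} → System X → System X → Set
Complement {X} I J = FinConc J × (∀ (B : X) → Σ (List (List X)) λ L →
    Unique L
  × (∀ xs → Derivable I B xs ⇔ (xs ∈ L))
  × (∀ ys → Derivable J B ys ⇔ Pointwise _∈_ ys L))

data Provable {X} (I : System X) : X → Set where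
  node : ∀ {B} (i : Idx I) (xs : List X) → R (rule I i) xs B →
         All (Provable I) xs → Provable I B

record HasProof {X} (I : System X) (B : X) : Set where
  coinductive
  field
    idx   : Idx I
    prems : List X
    der   : R (rule I idx) prems B
    subs  : All (HasProof I) prems

Equivalent : ∀ {X} → System X → System X → Set
Equivalent {X} I I' = ∀ (B : X) → Provable I B ⇔ Provable I' B

IsIntro : ∀ {X} → (X → X → Set) → Rule X → Set
IsIntro _≺_ r = ∀ {xs b} → R r xs b → All (_≺ b) xs

Intros : ∀ {X} → (X → X → Set) → System X → System X
Intros _≺_ I = record
  { Idx  = Σ (Idx I) (λ i → IsIntro _≺_ (rule I i))
  ; rule = λ p → rule I (proj₁ p) }

-- Composition: g composed with a list of rules or identities (nothing)

width : ∀ {X} → Maybe (Rule X) → ℕ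
width (just f) = arity f
width nothing  = 1

widths : ∀ {X} → List (Maybe (Rule X)) → ℕ
widths []       = 0
widths (m ∷ ms) = width m + widths ms

Apply : ∀ {X} → List (Maybe (Rule X)) → List X → List X → Set
Apply [] xs as = (xs ≡ []) × (as ≡ [])
Apply {X} (nothing ∷ fs) xs as = Σ X λ x → Σ (List X) λ xs' → Σ (List X) λ as' →
  (xs ≡ x ∷ xs') × (as ≡ x ∷ as') × Apply fs xs' as'
Apply {X} (just f ∷ fs) xs as = Σ (List X) λ ys → Σ (List X) λ xs' →
  Σ X λ a → Σ (List X) λ as' →
  (length ys ≡ arity f) × (xs ≡ ys ++ xs') × (as ≡ a ∷ as') × R f ys a
  × Apply fs xs' as'

compose : ∀ {X} → Rule X → List (Maybe (Rule X)) → Graph X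
compose {X} g fs = mkGraph (widths fs)
  (λ xs b → Σ (List X) λ as → Σ (Apply fs xs as) λ _ → R g as b)

data At {X : Set} : List X → ℕ → X → Set where
  here  : ∀ {x xs} → At (x ∷ xs) zero x
  there : ∀ {x y xs i} → At xs i y → At (x ∷ xs) (suc i) y

dropAt : ∀ {X : Set} → ℕ → List X → List X
dropAt _       []       = []
dropAt zero    (x ∷ xs) = xs
dropAt (suc j) (x ∷ xs) = x ∷ dropAt j xs

SameOnDom : ∀ {X} → Graph X → ℕ → ℕ → Set
SameOnDom h i j = ∀ xs b x y → G h xs b → At xs i x → At xs j y → x ≡ y

-- the rule obtained by dropping the j-th argument (when it always
-- equals another argument, it is recovered from that one)
dropArg : ∀ {X} → Graph X → ℕ → Graph X
dropArg {X} h j = mkGraph (g-arity h ∸ 1)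
  (λ ys b → Σ (List X) λ xs → G h xs b × (ys ≡ dropAt j xs))

NoPair : ∀ {X} → Graph X → Set
NoPair h = ∀ i j → i < g-arity h → j < g-arity h → ¬ (i ≡ j) →
           ¬ SameOnDom h i j

data Simp {X} : Graph X → Graph X → Set₁ where
  done : ∀ {h} → NoPair h → Simp h h
  step : ∀ {h h'} (i j : ℕ) → i < g-arity h → j < g-arity h → ¬ (i ≡ j) →
         SameOnDom h i j → Simp (dropArg h j) h' → Simp h h'

-- Saturation (w.r.t. an assignment maj of the number of major premises)

MajorOK : ∀ {X} → (X → X → Set) → (I : System X) → (Idx I → ℕ) → Set
MajorOK _≺_ I maj = ∀ i → ¬ IsIntro _≺_ (rule I i) →
  (1 ≤ maj i) × (maj i ≤ arity (rule I i))

Saturated : ∀ {X} → (X → X → Set) → (I : System X) → (Idx I → ℕ) → Set₁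
Saturated _≺_ I maj =
  ∀ (g : Idx I) → ¬ IsIntro _≺_ (rule I g) →
  ∀ (fs : List (Idx I)) → length fs ≡ maj g →
  All (λ f → IsIntro _≺_ (rule I f)) fs →
  Σ (Graph _) λ h →
    Simp (compose (rule I g)
           (map (just ∘ rule I) fs
             ++ replicate (arity (rule I g) ∸ maj g) nothing)) h
    × Contains I h

data Sequent (X : Set) : Set where
  ⊢_ : X → Sequent X
  ⊬_ : X → Sequent X

⊢-inj : ∀ {X} {a b : X} → (⊢ a) ≡ (⊢ b) → a ≡ b
⊢-inj refl = refl

⊬-inj : ∀ {X} {a b : X} → (⊬ a) ≡ (⊬ b) → a ≡ b
⊬-inj refl = refl

liftRule : ∀ {X} → (c : X → Sequent X) → (∀ {a b} → c a ≡ c b → a ≡ b) →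
           Rule X → Rule (Sequent X)
liftRule {X} c c-inj f = record
  { arity      = arity f
  ; R          = λ ys s → Σ (List X) λ xs → Σ X λ b →
                   (ys ≡ map c xs) × (s ≡ c b) × R f xs b
  ; arity-ok   = λ { (xs , b , refl , _ , d) →
                       trans (length-map c xs) (arity-ok f d) }
  ; functional = λ { (xs , b , e1 , refl , d) (xs' , b' , e2 , refl , d') →
                     cong c (functional f d
                       (subst (λ zs → R f zs b')
                          (sym (map-injective c-inj (trans (sym e1) e2))) d')) }
  }

Compl : ∀ {X} → System X → System X → System (Sequent X)
Compl A B = record
  { Idx  = Idx A ⊎ Idx B
  ; rule = λ { (inj₁ i) → liftRule ⊢_ ⊢-inj (rule A i)
             ; (inj₂ j) → liftRule ⊬_ ⊬-inj (rule B j) } }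

{-# OPTIONS --safe #-}
-- Let 𝒜 be the introduction rules of I'. Since every rule of 𝒜 has premises
-- below its conclusion, well-founded induction and the complement ℬ show that
-- each proposition either has a finite proof in 𝒜 or ⊬ of it has a proof in
-- 𝒜_ℬ, and never both. So if no Cᵢ were refuted, all Cᵢ would be provable in 𝒜.
-- But 𝒜 is closed under the rules of I' ⊇ I: a non-introduction rule applied to
-- 𝒜-proofs is, by saturation, replaced by a rule of I' whose premises are the
-- premises of the proofs of its major premises, which decreases the total size
-- of the premise proofs. Hence A would be provable in 𝒜, contradicting ⊬ A.
module Submission where

open import Defs
open import Data.List using (List; []; _∷_; _++_; map; length; replicate)
open import Data.Nat using (ℕ; zero; suc; _+_; _∸_; _≤_; _<_; z≤n; s≤s)
open import Data.Nat.Properties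
  using (+-assoc; +-commutativeSemigroup; +-monoʳ-≤; ≤-refl; ≤-trans; m≤n+m; m<n+m; module ≤-Reasoning)
open import Data.Nat.Induction using (<-wellFounded)
open import Algebra.Properties.CommutativeSemigroup +-commutativeSemigroup using (x∙yz≈y∙xz)
open import Data.Maybe using (just; nothing)
open import Data.Product using (Σ; _×_; _,_; proj₂)
open import Data.Sum using (_⊎_; inj₁; inj₂; swap; [_,_])
open import Data.Empty using (⊥; ⊥-elim)
open import Function using (_∘_)
open import Function.Bundles using (_⇔_; Equivalence)
open import Relation.Binary.PropositionalEquality using (_≡_; refl; sym; cong; subst; module ≡-Reasoning)
open import Relation.Binary.Structures using (IsStrictPartialOrder)
open import Induction.WellFounded using (WellFounded; Acc; acc)
open import Relation.Nullary using (¬_; yes; no)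
open import Relation.Nullary.Decidable.Core using (¬¬-excluded-middle)
open import Data.List.Membership.Propositional using (_∈_; find; lose)
open import Data.List.Relation.Unary.Any using (Any; here; there)
open import Data.List.Relation.Unary.All as All using (All; []; _∷_; decide)
open import Data.List.Relation.Unary.All.Properties using (++⁺; map⁺; map⁻)
open import Data.List.Relation.Binary.Pointwise using (Pointwise; []; _∷_)
open Equivalence

module _ {X : Set} {P Q : X → Set} where

  all-or-any : ∀ {xs} → All (λ x → P x ⊎ Q x) xs → All P xs ⊎ Any Q xs
  all-or-any [] = inj₁ []
  all-or-any (inj₁ p ∷ rest) with all-or-any rest
  ... | inj₁ ps = inj₁ (p ∷ ps)
  ... | inj₂ q  = inj₂ (there q)
  all-or-any (inj₂ q ∷ _) = inj₂ (here q)

module _ {X : Set} {Q : X → Set} where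

  choose : ∀ {L : List (List X)} → All (Any Q) L →
           Σ (List X) λ ys → Pointwise _∈_ ys L × All Q ys
  choose [] = [] , [] , []
  choose (q ∷ qs) with find q | choose qs
  ... | y , y∈xs , qy | ys , ys∈L , qys = y ∷ ys , y∈xs ∷ ys∈L , qy ∷ qys

pointwise-∈-meets : ∀ {X : Set} {ys xs : List X} {L : List (List X)} →
                    Pointwise _∈_ ys L → xs ∈ L → Σ X λ y → y ∈ ys × y ∈ xs
pointwise-∈-meets (y∈xs ∷ _) (here refl) = _ , here refl , y∈xs
pointwise-∈-meets (_ ∷ ys∈L) (there xs∈L) with pointwise-∈-meets ys∈L xs∈L
... | y , y∈ys , y∈xs = y , there y∈ys , y∈xs

Apply-identities : ∀ {X : Set} (xs : List X) → Apply (replicate (length xs) nothing) xs xs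
Apply-identities [] = refl , refl
Apply-identities (x ∷ xs) = x , xs , xs , refl , refl , Apply-identities xs

Refuted : ∀ {S} → System S → System S → S → Set
Refuted 𝒜 ℬ C = HasProof (Compl 𝒜 ℬ) (⊬ C)

module Complementation {S : Set} (𝒜 ℬ : System S) (compl : Complement 𝒜 ℬ) where

  refuted-by : ∀ {C} (j : Idx ℬ) (ys : List S) → R (rule ℬ j) ys C →
               All (Refuted 𝒜 ℬ) ys → Refuted 𝒜 ℬ C
  refuted-by j ys d hs .HasProof.idx   = inj₂ j
  refuted-by j ys d hs .HasProof.prems = map ⊬_ ys
  refuted-by j ys d hs .HasProof.der   = ys , _ , refl , refl , d
  refuted-by j ys d hs .HasProof.subs  = map⁺ hs

  refuted-inversion : ∀ {C} → Refuted 𝒜 ℬ C →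
    Σ (Idx ℬ) λ j → Σ (List S) λ ys → R (rule ℬ j) ys C × All (Refuted 𝒜 ℬ) ys
  refuted-inversion h = invert (HasProof.idx h) (HasProof.der h) (HasProof.subs h)
    where
      invert : ∀ {C ss} (i : Idx (Compl 𝒜 ℬ)) → R (rule (Compl 𝒜 ℬ) i) ss (⊬ C) →
               All (HasProof (Compl 𝒜 ℬ)) ss →
               Σ (Idx ℬ) λ j → Σ (List S) λ ys → R (rule ℬ j) ys C × All (Refuted 𝒜 ℬ) ys
      invert (inj₁ _) (_ , _ , _ , () , _) _
      invert (inj₂ j) (ys , _ , refl , refl , d) hs = j , ys , d , map⁻ hs

  -- ℬ picks one premise from each 𝒜-derivation of C, in particular one of xs.
  refuted-premise : ∀ {C xs} (k : Idx 𝒜) → R (rule 𝒜 k) xs C →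
                    Refuted 𝒜 ℬ C → Any (Refuted 𝒜 ℬ) xs
  refuted-premise {C} {xs} k d h with refuted-inversion h | proj₂ compl C
  ... | j , ys , d′ , hs | _ , _ , derivs , refutes
    with pointwise-∈-meets (to (refutes ys) (j , d′)) (to (derivs xs) (k , d))
  ... | y , y∈ys , y∈xs = lose y∈xs (All.lookup hs y∈ys)

  mutual
    provable⇒¬refuted : ∀ {C} → Provable 𝒜 C → ¬ Refuted 𝒜 ℬ C
    provable⇒¬refuted (node k xs d ps) h = provables⇒¬any-refuted ps (refuted-premise k d h)

    provables⇒¬any-refuted : ∀ {xs} → All (Provable 𝒜) xs → ¬ Any (Refuted 𝒜 ℬ) xs
    provables⇒¬any-refuted (p ∷ _)  (here h)  = provable⇒¬refuted p h
    provables⇒¬any-refuted (_ ∷ ps) (there h) = provables⇒¬any-refuted ps h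

  module _ {_≺_ : S → S → Set} (intro : ∀ k → IsIntro _≺_ (rule 𝒜 k)) where

    provable⊎refuted-step : ∀ {C} {L : List (List S)} →
      (∀ xs → Derivable 𝒜 C xs ⇔ (xs ∈ L)) → (∀ ys → Derivable ℬ C ys ⇔ Pointwise _∈_ ys L) →
      (∀ {y} → y ≺ C → Provable 𝒜 y ⊎ Refuted 𝒜 ℬ y) → Provable 𝒜 C ⊎ Refuted 𝒜 ℬ C
    provable⊎refuted-step {C} {L} derivs refutes below =
      [ refuted , provable ] (all-or-any (All.tabulate premises-decided))
      where
        premises-decided : ∀ {xs} → xs ∈ L → Any (Refuted 𝒜 ℬ) xs ⊎ All (Provable 𝒜) xs
        premises-decided {xs} xs∈L =
          let k , d = from (derivs xs) xs∈L in swap (all-or-any (All.map below (intro k d)))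

        refuted : All (Any (Refuted 𝒜 ℬ)) L → Provable 𝒜 C ⊎ Refuted 𝒜 ℬ C
        refuted choices =
          let ys , ys∈L , hs = choose choices
              j , d = from (refutes ys) ys∈L
          in inj₂ (refuted-by j ys d hs)

        provable : Any (All (Provable 𝒜)) L → Provable 𝒜 C ⊎ Refuted 𝒜 ℬ C
        provable derivation =
          let xs , xs∈L , ps = find derivation
              k , d = from (derivs xs) xs∈L
          in inj₁ (node k xs d ps)

    provable⊎refuted : ∀ {C} → Acc _≺_ C → Provable 𝒜 C ⊎ Refuted 𝒜 ℬ C
    provable⊎refuted {C} (acc rs) =
      let _ , _ , derivs , refutes = proj₂ compl C
      in provable⊎refuted-step derivs refutes (λ y≺C → provable⊎refuted (rs y≺C))

module Sizes {S : Set} (𝒜 : System S) where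

  mutual
    size : ∀ {C} → Provable 𝒜 C → ℕ
    size (node _ _ _ ps) = suc (sizes ps)

    sizes : ∀ {xs} → All (Provable 𝒜) xs → ℕ
    sizes []       = 0
    sizes (p ∷ ps) = size p + sizes ps

  sizes-++⁺ : ∀ {xs ys} (ps : All (Provable 𝒜) xs) (qs : All (Provable 𝒜) ys) →
              sizes (++⁺ ps qs) ≡ sizes ps + sizes qs
  sizes-++⁺ []       qs = refl
  sizes-++⁺ (p ∷ ps) qs = begin
    size p + sizes (++⁺ ps qs)       ≡⟨ cong (size p +_) (sizes-++⁺ ps qs) ⟩
    size p + (sizes ps + sizes qs)   ≡⟨ sym (+-assoc (size p) _ _) ⟩
    size p + sizes ps + sizes qs     ∎
    where open ≡-Reasoning

  sizes-dropAt : ∀ j {xs} (ps : All (Provable 𝒜) xs) →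
                 Σ (All (Provable 𝒜) (dropAt j xs)) λ ps′ → sizes ps′ ≤ sizes ps
  sizes-dropAt j       []       = [] , z≤n
  sizes-dropAt zero    (p ∷ ps) = ps , m≤n+m (sizes ps) (size p)
  sizes-dropAt (suc j) (p ∷ ps) with sizes-dropAt j ps
  ... | ps′ , ≤ps = p ∷ ps′ , +-monoʳ-≤ (size p) ≤ps

  Simp-transport : ∀ {h h′ xs b} → Simp h h′ → G h xs b → (ps : All (Provable 𝒜) xs) →
    Σ (List S) λ ys → G h′ ys b × Σ (All (Provable 𝒜) ys) λ qs → sizes qs ≤ sizes ps
  Simp-transport {xs = xs} (done _) g ps = xs , g , ps , ≤-refl
  Simp-transport {xs = xs} (step _ j _ _ _ _ s) g ps with sizes-dropAt j ps
  ... | ps′ , ≤ps with Simp-transport s (xs , g , refl) ps′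
  ...   | ys , g′ , qs , ≤ps′ = ys , g′ , qs , ≤-trans ≤ps′ ≤ps

module Saturation {S : Set} (_≺_ : S → S → Set) (I′ : System S) (maj : Idx I′ → ℕ)
                  (majorOK : MajorOK _≺_ I′ maj) (saturated : Saturated _≺_ I′ maj) where

  𝒜 : System S
  𝒜 = Intros _≺_ I′

  open Sizes 𝒜

  unfold-majors : ∀ m {xs} (ps : All (Provable 𝒜) xs) → m ≤ length xs →
    Σ (List (Idx I′)) λ fs → length fs ≡ m × All (λ f → IsIntro _≺_ (rule I′ f)) fs ×
    Σ (List S) λ xs′ → Σ (All (Provable 𝒜) xs′) λ ps′ → sizes ps ≡ m + sizes ps′ ×
    Apply (map (just ∘ rule I′) fs ++ replicate (length xs ∸ m) nothing) xs′ xs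
  unfold-majors zero {xs} ps _ = [] , refl , [] , xs , ps , refl , Apply-identities xs
  unfold-majors (suc m) (node (f , f-intro) ys d qs ∷ ps) (s≤s m≤∣xs∣)
    with unfold-majors m ps m≤∣xs∣
  ... | fs , ∣fs∣≡m , fs-intro , xs′ , ps′ , size-eq , apply =
    f ∷ fs , cong suc ∣fs∣≡m , f-intro ∷ fs-intro , ys ++ xs′ , ++⁺ qs ps′ , size-eq′ ,
    (ys , xs′ , _ , _ , arity-ok (rule I′ f) d , refl , refl , d , apply)
    where
      open ≡-Reasoning
      size-eq′ : suc (sizes qs + sizes ps) ≡ suc m + sizes (++⁺ qs ps′)
      size-eq′ = cong suc (begin
        sizes qs + sizes ps           ≡⟨ cong (sizes qs +_) size-eq ⟩
        sizes qs + (m + sizes ps′)    ≡⟨ x∙yz≈y∙xz (sizes qs) m (sizes ps′) ⟩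
        m + (sizes qs + sizes ps′)    ≡⟨ cong (m +_) (sym (sizes-++⁺ qs ps′)) ⟩
        m + sizes (++⁺ qs ps′)        ∎)

  major-reduction : ∀ {g xs b} → ¬ IsIntro _≺_ (rule I′ g) → R (rule I′ g) xs b →
    (ps : All (Provable 𝒜) xs) →
    Σ (Idx I′) λ k → Σ (List S) λ zs → R (rule I′ k) zs b ×
    Σ (All (Provable 𝒜) zs) λ qs → sizes qs < sizes ps
  major-reduction {g} {xs} {b} non-intro d ps =
    let 1≤m , m≤arity = majorOK g non-intro
        ∣xs∣≡arity = arity-ok (rule I′ g) d
        fs , ∣fs∣≡m , fs-intro , xs′ , ps′ , size-eq , apply =
          unfold-majors (maj g) ps (subst (maj g ≤_) (sym ∣xs∣≡arity) m≤arity)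
        h , simp , k , (_ , k≅h) = saturated g non-intro fs ∣fs∣≡m fs-intro
        apply′ = subst (λ n → Apply (map (just ∘ rule I′) fs ++ replicate (n ∸ maj g) nothing) xs′ xs)
                       ∣xs∣≡arity apply
        zs , h-zs , qs , qs≤ps′ = Simp-transport simp (xs , apply′ , d) ps′
        open ≤-Reasoning
    in k , zs , from (k≅h zs b) h-zs , qs , (begin-strict
         sizes qs            ≤⟨ qs≤ps′ ⟩
         sizes ps′           <⟨ m<n+m (sizes ps′) 1≤m ⟩
         maj g + sizes ps′   ≡⟨ sym size-eq ⟩
         sizes ps            ∎)

  -- IsIntro is not decidable, so only ¬¬ Provable can be concluded.
  derivable⇒¬¬provable : ∀ {g xs b} → R (rule I′ g) xs b → All (Provable 𝒜) xs →
                         ¬ ¬ Provable 𝒜 b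
  derivable⇒¬¬provable d ps = go d ps (<-wellFounded (sizes ps))
    where
      go : ∀ {g xs b} → R (rule I′ g) xs b → (ps : All (Provable 𝒜) xs) →
           Acc _<_ (sizes ps) → ¬ ¬ Provable 𝒜 b
      go {g} {xs} d ps (acc smaller) unprovable =
        ¬¬-excluded-middle {A = IsIntro _≺_ (rule I′ g)} λ where
          (yes intro) → unprovable (node (g , intro) xs d ps)
          (no non-intro) →
            let _ , _ , d′ , qs , qs<ps = major-reduction non-intro d ps
            in go d′ qs (smaller qs<ps) unprovable

proposition9 : {S : Set} (_≺_ : S → S → Set) →
    IsStrictPartialOrder _≡_ _≺_ → WellFounded _≺_ →
    (I J I' : System S) →
    FinConc I → Complement I J →
    Included I I' → Equivalent I I' →
    (maj : Idx I' → ℕ) → MajorOK _≺_ I' maj → Saturated _≺_ I' maj →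
    FinConc (Intros _≺_ I') →
    (B : System S) → Complement (Intros _≺_ I') B →
    (A : S) → HasProof (Compl (Intros _≺_ I') B) (⊬ A) →
    (Cs : List S) → Derivable I A Cs →
    Σ S λ C → (C ∈ Cs) × HasProof (Compl (Intros _≺_ I') B) (⊬ C)
proposition9 _≺_ _ wf _ _ I′ _ _ I⊆I′ _ maj majorOK saturated _ ℬ complement A refuted-A Cs (i , d) =
  [ ⊥-elim ∘ all-provable⇒⊥ , find ] (decide (λ C → provable⊎refuted proj₂ (wf C)) Cs)
  where
    open Complementation (Intros _≺_ I′) ℬ complement
    open Saturation _≺_ I′ maj majorOK saturated

    all-provable⇒⊥ : All (Provable 𝒜) Cs → ⊥
    all-provable⇒⊥ provable-Cs =
      let _ , _ , k≅i = I⊆I′ i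
      in derivable⇒¬¬provable (from (k≅i Cs A) d) provable-Cs
           (λ provable-A → provable⇒¬refuted provable-A refuted-A)
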